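{- Let $(\mathcal{M},X,\bot)$ be a concurrent system with $\mathcal M=\mathcal M(\Sigma,I)$, let $a\in\Sigma$, and let $x$ be an $a$-rooted linking execution from some state $\alpha\in X$. Let $\mathcal{M}^a=\langle\Sigma\setminus\{a\}\rangle$, and fix integers $p,q\ge0$ and a state $\beta\in X$. Then the map $$\varphi:\mathcal{M}_{\beta,\alpha}(p)\times\mathcal{M}^a_{\alpha\cdot x}(q)\to\mathcal{M}_\beta,\qquad (u,v)\mapsto uxv$$ is injective.
   Context: A trace monoid $\mathcal{M}=\mathcal{M}(\Sigma,I)$ is the monoid presented by $\langle \Sigma \mid ab=ba,\ (a,b)\in I\rangle$ with $\Sigma$ finite and $I\subseteq\Sigma\times\Sigma$ irreflexive symmetric; words are identified with their images in $\mathcal M$; $|x|$ is length; $D=(\Sigma\times\Sigma)\setminus I$; $\langle H\rangle$ is the submonoid generated by $H$. A concurrent system $(\mathcal{M},X,\bot)$: $X$ finite, $\bot\notin X$, right action of $\mathcal{M}$ on $X\cup\{\bot\}$ with $\bot\cdot x=\bot$. $\mathcal M_\beta=\{x:\beta\cdot x\ne\bot\}$, $\mathcal M_{\beta,\alpha}(p)=\{x\in\mathcal M_\beta:\beta\cdot x=\alpha,|x|=p\}$, $\mathcal M^a_{\gamma}(q)=\{v\in\mathcal M^a:\gamma\cdot v\ne\bot,|v|=q\}$. A linking sequence from $\alpha$ is a sequence of letters $a_1,\dots,a_p$ such that, for some indices $1\le j_1<\dots<j_q\le p$: $\alpha\cdot(a_1\cdots a_p)\neq\bot$; $(a_{j_k},a_{j_{k+1}})\in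 D$ for $k=1,\dots,q-1$; every letter of $\Sigma$ occurs in $(a_{j_1},\dots,a_{j_q})$. It is $a$-rooted if the indices can be chosen with $a_{j_1}=a$. An $a$-rooted linking execution from $\alpha$ is the image in $\mathcal{M}$ of an $a$-rooted linking sequence from $\alpha$. -}

module Defs where

open import Level using (Level; 0ℓ; suc)
open import Data.Nat using (ℕ)
open import Data.Fin using (Fin)
open import Data.Maybe using (Maybe; just; nothing; _>>=_)
open import Data.List using (List; []; _∷_; _++_; length)
open import Data.List.Membership.Propositional using (_∈_)
open import Data.List.Relation.Unary.All using (All)
open import Data.List.Relation.Unary.Linked using (Linked)
open import Data.List.Relation.Binary.Sublist.Propositional using (_⊆_)
open import Data.Product using (Σ; ∃; _×_; _,_)
open import Relation.Binary.PropositionalEquality using (_≡_; _≢_)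
open import Relation.Nullary using (¬_)

record Alphabet : Set₁ where
  field
    n     : ℕ
    I     : Fin n → Fin n → Set
    irrefl : ∀ a → ¬ I a a
    sym    : ∀ a b → I a b → I b a

  Letter : Set
  Letter = Fin n

  Word : Set
  Word = List Letter

  D : Letter → Letter → Set
  D a b = ¬ I a b

  -- Trace equivalence: the congruence on words generated by ab = ba, (a,b) ∈ I.
  -- Words are identified with their images in M(Σ,I); equality in M is _≈_.
  data _≈_ : Word → Word → Set where
    ≈-refl  : ∀ {u} → u ≈ u
    ≈-sym   : ∀ {u v} → u ≈ v → v ≈ u
    ≈-trans : ∀ {u v w} → u ≈ v → v ≈ w → u ≈ w
    ≈-swap  : ∀ u v {a b} → I a b → (u ++ a ∷ b ∷ v) ≈ (u ++ b ∷ a ∷ v)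

-- right action of words on X ∪ {⊥} = Maybe (Fin m) induced by a letter action,
-- with ⊥ · x = ⊥ (nothing = ⊥)
act : ∀ {n m} → (Fin m → Fin n → Maybe (Fin m)) → Maybe (Fin m) → List (Fin n) → Maybe (Fin m)
act step s []      = s
act step s (c ∷ w) = act step (s >>= λ α → step α c) w

-- The action of M is given by the action of letters
-- on states; it is a right action of M(Σ,I) exactly when the commutation
-- relations are respected (field commute).
record ConcurrentSystem (A : Alphabet) : Set₁ where
  open Alphabet A
  field
    m    : ℕ
    step : Fin m → Letter → Maybe (Fin m)
    commute : ∀ (α : Fin m) {a b} → I a b →
              act step (just α) (a ∷ b ∷ []) ≡ act step (just α) (b ∷ a ∷ [])

  State : Set
  State = Fin m

  _·_ : Maybe State → Word → Maybe State
  _·_ = act step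

  InMβα : State → State → ℕ → Word → Set
  InMβα β α p u = (just β · u ≡ just α) × length u ≡ p

  InMaγ : Letter → Maybe State → ℕ → Word → Set
  InMaγ a γ q v = All (λ c → c ≢ a) v × (γ · v ≢ nothing) × length v ≡ q

  ARootedLinkingSeq : Letter → State → Word → Set
  ARootedLinkingSeq a α w =
    (just α · w ≢ nothing) ×
    ∃ λ ys → (a ∷ ys) ⊆ w × Linked D (a ∷ ys) × (∀ c → c ∈ (a ∷ ys))

  ARootedLinkingExec : Letter → State → Word → Set
  ARootedLinkingExec a α x = ∃ λ w → ARootedLinkingSeq a α w × Alphabet._≈_ A w x

-- For every letter c the subword of occurrences of c is a trace invariant, and so,
-- for dependent letters s and t, is the projection π onto {s, t}. As v and v' avoid a,
-- u and u' contain equally many a's. If u and u' agree on a letter s occurring in x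
-- and t depends on s, the projections of u x v and u' x v' onto {s, t} are equal words
-- sharing the factor π x ∋ s at the same place, which forces π u = π u'; so u and u'
-- agree on t. Walking the dependence chain of the linking execution, which lies in x
-- and visits every letter, u and u' get equal Parikh vectors, and a trace equation
-- w₁ w₂ ≈ w₁' w₂' with Parikh-equal w₁, w₁' splits into w₁ ≈ w₁' and w₂ ≈ w₂'.
module Submission where

open import Defs
open import Level using (Level; _⊔_)
open import Data.Bool using (Bool; true; false)
open import Data.Bool.Properties using () renaming (_≟_ to _≟ᵇ_)
open import Data.Fin using (_≟_)
open import Data.Nat using (ℕ)
open import Data.Maybe using (just)
open import Data.List using (List; []; _∷_; _++_; [_]; map; filter)
open import Data.List.Properties
  using (∷-injective; ∷-injectiveˡ; ∷-injectiveʳ; ++-assoc; ++-cancelˡ; ++-cancelʳ; ++-conicalʳ;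
         map-++; map-∘; map-id; filter-++; filter-accept; filter-reject; filter-none)
open import Data.List.Membership.Propositional using (_∈_; _∉_)
open import Data.List.Membership.Propositional.Properties using (∈-++⁻; ∈-filter⁺; ∈-filter⁻)
open import Data.List.Relation.Unary.All as All using (All; []; _∷_; lookup)
open import Data.List.Relation.Unary.All.Properties using (all-filter)
open import Data.List.Relation.Unary.Any using (here; there)
open import Data.List.Relation.Unary.Linked using (Linked; [-]; _∷_)
open import Data.List.Relation.Binary.Sublist.Propositional.Properties using (All-resp-⊆)
open import Data.Product using (_×_; _,_; proj₁; proj₂; ∃-syntax)
open import Data.Sum using (_⊎_; inj₁; inj₂)
open import Function using (_∘_; _on_; case_of_)
open import Relation.Nullary using (¬_; does; yes; no; contradiction)
open import Relation.Nullary.Decidable using (_⊎-dec_)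
open import Relation.Unary using (Pred; Decidable; _⊆_)
open import Relation.Binary using (Rel; Symmetric; DecidableEquality)
open import Relation.Binary.PropositionalEquality
  using (_≡_; _≢_; refl; sym; trans; cong; cong₂; subst; subst₂; module ≡-Reasoning)
open import Relation.Binary.Construct.Closure.ReflexiveTransitive using (Star; ε; _◅_; _◅◅_; gmap; kleisliStar; reverse)

open ≡-Reasoning

private variable
  a b p q r : Level
  A : Set a
  B : Set b

module _ {P : Pred A p} (P? : Decidable P) where

  filter-++₃ : ∀ xs ys zs → filter P? (xs ++ ys ++ zs) ≡ filter P? xs ++ filter P? ys ++ filter P? zs
  filter-++₃ xs ys zs = trans (filter-++ P? xs _) (cong (filter P? xs ++_) (filter-++ P? ys zs))

  filter-∷-cancel : ∀ x {xs ys} → filter P? (x ∷ xs) ≡ filter P? (x ∷ ys) → filter P? xs ≡ filter P? ys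
  filter-∷-cancel x eq with does (P? x)
  ... | true  = ∷-injectiveʳ eq
  ... | false = eq

  filter-filter : {Q : Pred A q} (Q? : Decidable Q) → Q ⊆ P → ∀ xs → filter Q? (filter P? xs) ≡ filter Q? xs
  filter-filter Q? Q⊆P [] = refl
  filter-filter Q? Q⊆P (x ∷ xs) with P? x
  ... | no ¬Px = trans (filter-filter Q? Q⊆P xs) (sym (filter-reject Q? (¬Px ∘ Q⊆P)))
  ... | yes _ with does (Q? x)
  ...   | true  = cong (x ∷_) (filter-filter Q? Q⊆P xs)
  ...   | false = filter-filter Q? Q⊆P xs

data Swap {A : Set a} (R : Rel A r) : Rel (List A) (a ⊔ r) where
  here  : ∀ {x y w} → R x y → Swap R (x ∷ y ∷ w) (y ∷ x ∷ w)
  there : ∀ {x w w'} → Swap R w w' → Swap R (x ∷ w) (x ∷ w')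

Swaps : {A : Set a} → Rel A r → Rel (List A) (a ⊔ r)
Swaps R = Star (Swap R)

Clique : {A : Set a} → Rel A r → Pred A p → Set (a ⊔ r ⊔ p)
Clique R P = ∀ {x y} → P x → P y → ¬ R x y

module _ {R : Rel A r} where

  Swap-sym : Symmetric R → Symmetric (Swap R)
  Swap-sym R-sym (here xRy) = here (R-sym xRy)
  Swap-sym R-sym (there s)  = there (Swap-sym R-sym s)

  Swap-++ : ∀ u {w w'} → Swap R w w' → Swap R (u ++ w) (u ++ w')
  Swap-++ []      s = s
  Swap-++ (x ∷ u) s = there (Swap-++ u s)

  module _ {P : Pred A p} (P? : Decidable P) where

    filter-Swap : ∀ {w w'} → Swap R w w' → Swaps R (filter P? w) (filter P? w')
    filter-Swap (here {x} {y} xRy) with does (P? x) in Px | does (P? y) in Py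
    ... | true  | true  rewrite Px | Py = here xRy ◅ ε
    ... | true  | false rewrite Px | Py = ε
    ... | false | true  rewrite Px | Py = ε
    ... | false | false rewrite Px | Py = ε
    filter-Swap (there {x} s) with does (P? x)
    ... | true  = gmap (x ∷_) there (filter-Swap s)
    ... | false = filter-Swap s

    filter-Swaps : ∀ {w w'} → Swaps R w w' → Swaps R (filter P? w) (filter P? w')
    filter-Swaps = kleisliStar (filter P?) filter-Swap

  module _ {P : Pred A p} (clique : Clique R P) where

    Swap-clique : ∀ {w w'} → All P w → ¬ Swap R w w'
    Swap-clique (Px ∷ Py ∷ _) (here xRy) = clique Px Py xRy
    Swap-clique (_ ∷ Pw)      (there s)  = Swap-clique Pw s

    Swaps-clique : ∀ {w w'} → All P w → Swaps R w w' → w ≡ w'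
    Swaps-clique _  ε       = refl
    Swaps-clique Pw (s ◅ _) = contradiction s (Swap-clique Pw)

    filter-clique : (P? : Decidable P) → ∀ {w w'} → Swaps R w w' → filter P? w ≡ filter P? w'
    filter-clique P? {w} ss = Swaps-clique (all-filter P? w) (filter-Swaps P? ss)

module _ {R : Rel A r} (f : B → A) where

  map-Swap : ∀ {T T'} → Swap (R on f) T T' → Swap R (map f T) (map f T')
  map-Swap (here xRy) = here xRy
  map-Swap (there s)  = there (map-Swap s)

  map-Swaps : ∀ {T T'} → Swaps (R on f) T T' → Swaps R (map f T) (map f T')
  map-Swaps = gmap (map f) map-Swap

  lift-Swap : ∀ {T w w'} → Swap R w w' → map f T ≡ w → ∃[ T' ] map f T' ≡ w' × Swap (R on f) T T'
  lift-Swap {x ∷ y ∷ T} (here xRy) refl = y ∷ x ∷ T , refl , here xRy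
  lift-Swap {x ∷ T} (there s) refl =
    let T' , eq , s' = lift-Swap s refl in x ∷ T' , cong (f x ∷_) eq , there s'

  lift-Swaps : ∀ {T w w'} → Swaps R w w' → map f T ≡ w → ∃[ T' ] map f T' ≡ w' × Swaps (R on f) T T'
  lift-Swaps ε eq = _ , eq , ε
  lift-Swaps (s ◅ ss) eq =
    let T₁ , eq₁ , s₁  = lift-Swap s eq
        T₂ , eq₂ , ss₂ = lift-Swaps ss eq₁
    in T₂ , eq₂ , s₁ ◅ ss₂

shift-≡[] : ∀ {s : A} {X Z V V'} → s ∈ X → s ∉ Z → X ++ V ≡ Z ++ X ++ V' → Z ≡ []
shift-≡[] {Z = []} _ _ _ = refl
shift-≡[] {X = c ∷ X} {Z = z ∷ Z} {V' = V'} s∈cX s∉zZ eq with ∷-injective eq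
... | refl , eq' with s∈cX
...   | here refl  = contradiction (here refl) s∉zZ
...   | there s∈X  =
  case ++-conicalʳ Z [ c ] (shift-≡[] s∈X s∉Zc (trans eq' (sym (++-assoc Z [ c ] (X ++ V'))))) of λ ()
  where
  s∉Zc : _ ∉ Z ++ [ c ]
  s∉Zc s∈Zc with ∈-++⁻ Z s∈Zc
  ... | inj₁ s∈Z         = s∉zZ (there s∈Z)
  ... | inj₂ (here refl) = s∉zZ (here refl)

module Occurrences {A : Set a} (_≟_ : DecidableEquality A) where

  filter-≡[]⇒∉ : ∀ {s Z} → filter (_≟ s) Z ≡ [] → s ∉ Z
  filter-≡[]⇒∉ eq s∈Z = case subst (_ ∈_) eq (∈-filter⁺ (_≟ _) s∈Z refl) of λ ()

  ++-cancel-around : ∀ {s U U' X V V'} → s ∈ X → filter (_≟ s) U ≡ filter (_≟ s) U' →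
                     U ++ X ++ V ≡ U' ++ X ++ V' → U ≡ U'
  ++-cancel-around {U = []}    {[]}    _ _ _ = refl
  ++-cancel-around {U = []}    {_ ∷ _} s∈X same eq =
    case shift-≡[] s∈X (filter-≡[]⇒∉ (sym same)) eq of λ ()
  ++-cancel-around {U = _ ∷ _} {[]}    s∈X same eq =
    case shift-≡[] s∈X (filter-≡[]⇒∉ same) (sym eq) of λ ()
  ++-cancel-around {U = c ∷ _} {_ ∷ _} s∈X same eq with ∷-injective eq
  ... | refl , eq' = cong (c ∷_) (++-cancel-around s∈X (filter-∷-cancel (_≟ _) c same) eq')

  letter? : (c : A) → Decidable {A = A × B} ((_≡ c) ∘ proj₁)
  letter? c (x , _) = x ≟ c

  ≡-by-letters : ∀ {T T' : List (A × B)} → map proj₁ T ≡ map proj₁ T' →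
                 (∀ c → filter (letter? c) T ≡ filter (letter? c) T') → T ≡ T'
  ≡-by-letters {T = []}          {[]}            _  _    = refl
  ≡-by-letters {T = (c , b) ∷ T} {(_ , b′) ∷ T'} eq same with ∷-injective eq
  ... | refl , eq'
      with refl ← ∷-injectiveˡ (trans (sym (filter-accept (letter? c) refl))
                                      (trans (same c) (filter-accept (letter? c) refl)))
      = cong ((c , b) ∷_) (≡-by-letters eq' (λ d → filter-∷-cancel (letter? d) _ (same d)))

  tagSplit : List A → List A → List (A × Bool)
  tagSplit w₁ w₂ = map (_, true) w₁ ++ map (_, false) w₂

  tagged? : (b : Bool) → Decidable {A = A × Bool} ((_≡ b) ∘ proj₂)
  tagged? b (_ , b′) = b′ ≟ᵇ b

  keep : Bool → List (A × Bool) → List A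
  keep b = map proj₁ ∘ filter (tagged? b)

  proj₁-tagSplit : ∀ w₁ w₂ → map proj₁ (tagSplit w₁ w₂) ≡ w₁ ++ w₂
  proj₁-tagSplit w₁ w₂ = trans (map-++ proj₁ (map (_, true) w₁) _) (cong₂ _++_ (untag true w₁) (untag false w₂))
    where
    untag : ∀ b (w : List A) → map proj₁ (map (_, b) w) ≡ w
    untag _ w = trans (sym (map-∘ w)) (map-id w)

  filter-tagSplit : ∀ c w₁ w₂ →
                    filter (letter? c) (tagSplit w₁ w₂) ≡ tagSplit (filter (_≟ c) w₁) (filter (_≟ c) w₂)
  filter-tagSplit c w₁ w₂ = trans (filter-++ (letter? c) (map (_, true) w₁) _) (cong₂ _++_ (filter-tag w₁) (filter-tag w₂))
    where
    filter-tag : ∀ {b} w → filter (letter? c) (map (_, b) w) ≡ map (_, b) (filter (_≟ c) w)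
    filter-tag [] = refl
    filter-tag {b} (x ∷ w) with x ≟ c
    ... | yes _ = cong ((x , b) ∷_) (filter-tag w)
    ... | no _  = filter-tag w

  keep-true-tagSplit : ∀ w₁ w₂ → keep true (tagSplit w₁ w₂) ≡ w₁
  keep-true-tagSplit []       []       = refl
  keep-true-tagSplit []       (_ ∷ w₂) = keep-true-tagSplit [] w₂
  keep-true-tagSplit (x ∷ w₁) w₂       = cong (x ∷_) (keep-true-tagSplit w₁ w₂)

  keep-false-tagSplit : ∀ w₁ w₂ → keep false (tagSplit w₁ w₂) ≡ w₂
  keep-false-tagSplit []       []       = refl
  keep-false-tagSplit []       (x ∷ w₂) = cong (x ∷_) (keep-false-tagSplit [] w₂)
  keep-false-tagSplit (_ ∷ w₁) w₂       = keep-false-tagSplit w₁ w₂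

  keep-Swaps : {R : Rel A r} (b : Bool) → ∀ {T T'} → Swaps (R on proj₁) T T' → Swaps R (keep b T) (keep b T')
  keep-Swaps b = map-Swaps proj₁ ∘ filter-Swaps (tagged? b)

module Traces (𝒜 : Alphabet) where

  open Alphabet 𝒜 renaming (sym to I-sym)
  open Occurrences (_≟_ {n})

  ∷-≈ : ∀ c {w w'} → w ≈ w' → (c ∷ w) ≈ (c ∷ w')
  ∷-≈ c ≈-refl           = ≈-refl
  ∷-≈ c (≈-sym e)        = ≈-sym (∷-≈ c e)
  ∷-≈ c (≈-trans e e')   = ≈-trans (∷-≈ c e) (∷-≈ c e')
  ∷-≈ c (≈-swap u v xIy) = ≈-swap (c ∷ u) v xIy

  Swap⇒≈ : ∀ {w w'} → Swap I w w' → w ≈ w'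
  Swap⇒≈ (here xIy) = ≈-swap [] _ xIy
  Swap⇒≈ (there s)  = ∷-≈ _ (Swap⇒≈ s)

  Swaps⇒≈ : ∀ {w w'} → Swaps I w w' → w ≈ w'
  Swaps⇒≈ ε        = ≈-refl
  Swaps⇒≈ (s ◅ ss) = ≈-trans (Swap⇒≈ s) (Swaps⇒≈ ss)

  ≈⇒Swaps : ∀ {w w'} → w ≈ w' → Swaps I w w'
  ≈⇒Swaps ≈-refl           = ε
  ≈⇒Swaps (≈-sym e)        = reverse (Swap-sym (I-sym _ _)) (≈⇒Swaps e)
  ≈⇒Swaps (≈-trans e e')   = ≈⇒Swaps e ◅◅ ≈⇒Swaps e'
  ≈⇒Swaps (≈-swap u _ xIy) = Swap-++ u (here xIy) ◅ ε

  letter-clique : ∀ c → Clique I (_≡ c)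
  letter-clique c refl refl = irrefl c

  pair-clique : ∀ {s t} → D s t → Clique I (λ c → c ≡ s ⊎ c ≡ t)
  pair-clique {s}     _ (inj₁ refl) (inj₁ refl) = irrefl s
  pair-clique         d (inj₁ refl) (inj₂ refl) = d
  pair-clique         d (inj₂ refl) (inj₁ refl) = d ∘ I-sym _ _
  pair-clique {t = t} _ (inj₂ refl) (inj₂ refl) = irrefl t

  filter-resp-≈ : {P : Pred Letter p} → Clique I P → (P? : Decidable P) → ∀ {w w'} → w ≈ w' → filter P? w ≡ filter P? w'
  filter-resp-≈ clique P? = filter-clique clique P? ∘ ≈⇒Swaps

  occurrences-resp-≈ : ∀ c {w w'} → w ≈ w' → filter (_≟ c) w ≡ filter (_≟ c) w'
  occurrences-resp-≈ c = filter-resp-≈ (letter-clique c) (_≟ c)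

  ∈-resp-≈ : ∀ {c w w'} → c ∈ w → w ≈ w' → c ∈ w'
  ∈-resp-≈ c∈w e = proj₁ (∈-filter⁻ (_≟ _) (subst (_ ∈_) (occurrences-resp-≈ _ e) (∈-filter⁺ (_≟ _) c∈w refl)))

  -- Tag the letters of w₁ and w₂, replay the exchanges on the tagged word: since equal
  -- letters never exchange, the tags of each letter stay in order, so the result is
  -- the tagging of w₁' and w₂'.
  ≈-cancel-prefix : ∀ {w₁ w₂ w₁' w₂'} → (w₁ ++ w₂) ≈ (w₁' ++ w₂') →
                    (∀ c → filter (_≟ c) w₁ ≡ filter (_≟ c) w₁') → w₁ ≈ w₁' × w₂ ≈ w₂'
  ≈-cancel-prefix {w₁} {w₂} {w₁'} {w₂'} e same =
    Swaps⇒≈ (subst₂ (Swaps I) (keep-true-tagSplit w₁ w₂) (keep-true-tagSplit w₁' w₂') (keep-Swaps true T₀↝T₁)) ,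
    Swaps⇒≈ (subst₂ (Swaps I) (keep-false-tagSplit w₁ w₂) (keep-false-tagSplit w₁' w₂') (keep-Swaps false T₀↝T₁))
    where
    suffix-same : ∀ c → filter (_≟ c) w₂ ≡ filter (_≟ c) w₂'
    suffix-same c = ++-cancelˡ (filter (_≟ c) w₁') _ _ (begin
      filter (_≟ c) w₁' ++ filter (_≟ c) w₂ ≡⟨ cong (_++ _) (same c) ⟨
      filter (_≟ c) w₁ ++ filter (_≟ c) w₂  ≡⟨ filter-++ (_≟ c) w₁ w₂ ⟨
      filter (_≟ c) (w₁ ++ w₂)              ≡⟨ occurrences-resp-≈ c e ⟩
      filter (_≟ c) (w₁' ++ w₂')            ≡⟨ filter-++ (_≟ c) w₁' w₂' ⟩
      filter (_≟ c) w₁' ++ filter (_≟ c) w₂' ∎)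

    T₀↝T₁ : Swaps (I on proj₁) (tagSplit w₁ w₂) (tagSplit w₁' w₂')
    T₀↝T₁ with T' , T'-letters , T₀↝T' ← lift-Swaps proj₁ (≈⇒Swaps e) (proj₁-tagSplit w₁ w₂) =
      subst (Swaps _ _) (≡-by-letters (trans T'-letters (sym (proj₁-tagSplit w₁' w₂'))) letters-≡) T₀↝T'
      where
      letters-≡ : ∀ c → filter (letter? c) T' ≡ filter (letter? c) (tagSplit w₁' w₂')
      letters-≡ c = begin
        filter (letter? c) T'                                    ≡⟨ filter-clique (letter-clique c) (letter? c) T₀↝T' ⟨
        filter (letter? c) (tagSplit w₁ w₂)                      ≡⟨ filter-tagSplit c w₁ w₂ ⟩
        tagSplit (filter (_≟ c) w₁) (filter (_≟ c) w₂)           ≡⟨ cong₂ tagSplit (same c) (suffix-same c) ⟩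
        tagSplit (filter (_≟ c) w₁') (filter (_≟ c) w₂')         ≡⟨ filter-tagSplit c w₁' w₂' ⟨
        filter (letter? c) (tagSplit w₁' w₂')                    ∎

  module CommonFactor {u u' x v v' : Word} (e : (u ++ x ++ v) ≈ (u' ++ x ++ v')) where

    occurrences-before-free-suffix : ∀ {c} → All (_≢ c) v → All (_≢ c) v' → filter (_≟ c) u ≡ filter (_≟ c) u'
    occurrences-before-free-suffix {c} v-free v'-free = ++-cancelʳ (f x ++ []) (f u) (f u') (begin
      f u ++ f x ++ []    ≡⟨ cong (λ y → f u ++ f x ++ y) (filter-none (_≟ c) v-free) ⟨
      f u ++ f x ++ f v   ≡⟨ filter-++₃ (_≟ c) u x v ⟨
      f (u ++ x ++ v)     ≡⟨ occurrences-resp-≈ c e ⟩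
      f (u' ++ x ++ v')   ≡⟨ filter-++₃ (_≟ c) u' x v' ⟩
      f u' ++ f x ++ f v' ≡⟨ cong (λ y → f u' ++ f x ++ y) (filter-none (_≟ c) v'-free) ⟩
      f u' ++ f x ++ []   ∎)
      where
      f : Word → Word
      f = filter (_≟ c)

    -- Projecting onto the dependent pair {s, t} turns the trace equation into a word
    -- equation, in which the common factor x pins down the prefix.
    dependent-step : ∀ {s t} → D s t → s ∈ x → filter (_≟ s) u ≡ filter (_≟ s) u' → filter (_≟ t) u ≡ filter (_≟ t) u'
    dependent-step {s} {t} d s∈x same = begin
      filter (_≟ t) u      ≡⟨ filter-filter st? (_≟ t) inj₂ u ⟨
      filter (_≟ t) (π u)  ≡⟨ cong (filter (_≟ t)) π-≡ ⟩
      filter (_≟ t) (π u') ≡⟨ filter-filter st? (_≟ t) inj₂ u' ⟩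
      filter (_≟ t) u'     ∎
      where
      st? : Decidable (λ c → c ≡ s ⊎ c ≡ t)
      st? c = c ≟ s ⊎-dec c ≟ t

      π : Word → Word
      π = filter st?

      π-≡ : π u ≡ π u'
      π-≡ = ++-cancel-around (∈-filter⁺ st? s∈x (inj₁ refl))
        (trans (filter-filter st? (_≟ s) inj₁ u) (trans same (sym (filter-filter st? (_≟ s) inj₁ u'))))
        (begin
          π u ++ π x ++ π v    ≡⟨ filter-++₃ st? u x v ⟨
          π (u ++ x ++ v)      ≡⟨ filter-resp-≈ (pair-clique d) st? e ⟩
          π (u' ++ x ++ v')    ≡⟨ filter-++₃ st? u' x v' ⟩
          π u' ++ π x ++ π v'  ∎)

    linked-occurrences : ∀ {c cs} → Linked D (c ∷ cs) → All (_∈ x) (c ∷ cs) →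
                         filter (_≟ c) u ≡ filter (_≟ c) u' → All (λ d → filter (_≟ d) u ≡ filter (_≟ d) u') (c ∷ cs)
    linked-occurrences [-]       _            same = same ∷ []
    linked-occurrences (d ∷ lnk) (c∈x ∷ cs∈x) same =
      same ∷ linked-occurrences lnk cs∈x (dependent-step d c∈x same)

open Alphabet using (Letter; Word; _≈_)
open ConcurrentSystem using (State; _·_; ARootedLinkingExec; InMβα; InMaγ)

lemma1 : (A : Alphabet) (S : ConcurrentSystem A) →
    (a : Letter A) (α : State S) (x : Word A) → ARootedLinkingExec S a α x →
    (p q : ℕ) (β : State S) →
    (u u' v v' : Word A) →
    InMβα S β α p u → InMβα S β α p u' →
    InMaγ S a (_·_ S (just α) x) q v → InMaγ S a (_·_ S (just α) x) q v' →
    _≈_ A (u ++ x ++ v) (u' ++ x ++ v') →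
    _≈_ A u u' × _≈_ A v v'
lemma1 A S a α x (w , (_ , ys , chain⊆w , linked , covering) , w≈x) p q β u u' v v' _ _ (v-a-free , _) (v'-a-free , _) e =
  proj₁ (≈-cancel-prefix e same) , proj₂ (≈-cancel-prefix e' same-with-x)
  where
  open Traces A
  open CommonFactor {u} {u'} {x} {v} {v'} e

  chain⊆x : All (_∈ x) (a ∷ ys)
  chain⊆x = All-resp-⊆ chain⊆w (All.tabulate (λ c∈w → ∈-resp-≈ c∈w w≈x))

  same : ∀ c → filter (_≟ c) u ≡ filter (_≟ c) u'
  same c = lookup (linked-occurrences linked chain⊆x (occurrences-before-free-suffix v-a-free v'-a-free)) (covering c)

  same-with-x : ∀ c → filter (_≟ c) (u ++ x) ≡ filter (_≟ c) (u' ++ x)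
  same-with-x c = trans (filter-++ (_≟ c) u x) (trans (cong (_++ _) (same c)) (sym (filter-++ (_≟ c) u' x)))

  e' : _≈_ A ((u ++ x) ++ v) ((u' ++ x) ++ v')
  e' = subst₂ (_≈_ A) (sym (++-assoc u x v)) (sym (++-assoc u' x v')) e
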